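{- Let $G$ be a graph and $S$ a DET:OLD set of $G$. Then every vertex $v\in V(G)$ has at most one neighbor of degree $2$.
   Context: For a graph $G$ and $v\in V(G)$, $N(v)$ is the open neighborhood of $v$. For $S\subseteq V(G)$ write $N_S(v)=N(v)\cap S$. A set $S\subseteq V(G)$ is a DET:OLD set of $G$ if (1) every vertex $v\in V(G)$ satisfies $|N_S(v)|\ge 2$, and (2) every pair of distinct vertices $u,v\in V(G)$ satisfies $|N_S(u)\setminus N_S(v)|\ge 2$ or $|N_S(v)\setminus N_S(u)|\ge 2$. -}

module Defs where

open import Data.Nat using (ℕ; _≥_)
open import Data.Bool using (Bool; true; false)
open import Data.Fin using (Fin)
open import Data.Fin.Subset using (Subset; _∩_; _─_; ∣_∣)
open import Data.Vec using (tabulate)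
open import Data.Product using (_×_)
open import Data.Sum using (_⊎_)
open import Relation.Binary.PropositionalEquality using (_≡_)
open import Relation.Nullary using (¬_)

record Graph (n : ℕ) : Set where
  field
    adj     : Fin n → Fin n → Bool
    adj-sym : ∀ u v → adj u v ≡ adj v u
    adj-irr : ∀ v → adj v v ≡ false
open Graph public

N : ∀ {n} → Graph n → Fin n → Subset n
N G v = tabulate (λ u → adj G v u)

deg : ∀ {n} → Graph n → Fin n → ℕ
deg G v = ∣ N G v ∣

N[_] : ∀ {n} → Graph n → Subset n → Fin n → Subset n
N[ G ] S v = N G v ∩ S

Adjacent : ∀ {n} → Graph n → Fin n → Fin n → Set
Adjacent G u v = adj G u v ≡ true

IsDETOLD : ∀ {n} → Graph n → Subset n → Set
IsDETOLD G S =
  (∀ v → ∣ N[ G ] S v ∣ ≥ 2) ×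
  (∀ u v → ¬ u ≡ v →
     (∣ N[ G ] S u ─ N[ G ] S v ∣ ≥ 2) ⊎ (∣ N[ G ] S v ─ N[ G ] S u ∣ ≥ 2))

-- A vertex u of degree 2 has both of its neighbours in N_S(u), because
-- |N_S(u)| ≥ 2 and N_S(u) ⊆ N(u). So if two distinct vertices u, w of degree 2
-- share a neighbour v, then v lies in N_S(u) ∩ N_S(w), and each of the two
-- differences N_S(u) ∖ N_S(w), N_S(w) ∖ N_S(u) has at most 2 − 1 = 1 element,
-- contradicting the separation condition.
module Submission where

open import Defs
open import Data.Nat using (_≤_; _<_; _≥_)
open import Data.Nat.Properties using (≤-trans; <-≤-trans; <⇒≱; ≤-reflexive)
open import Data.Fin using (Fin)
open import Data.Fin.Properties using (_≟_)
open import Data.Fin.Subset using (Subset; _∈_; _∉_; _⊆_; _∩_; _─_; ∣_∣)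
open import Data.Fin.Subset.Properties
  using (_∈?_; p∩q⊆p; p∩q⊆q; x∈p∩q⁺; p⊂q⇒∣p∣<∣q∣; ∣p∩q∣≤∣p∣; p∩q≢∅⇒∣p─q∣<∣p∣)
open import Data.Vec.Properties using (lookup⇒[]=; lookup∘tabulate)
open import Data.Product using (_,_)
open import Data.Sum using ([_,_])
open import Relation.Nullary using (yes; no; contradiction)
open import Relation.Binary.PropositionalEquality using (_≡_; trans)

adjacent⇒∈N : ∀ {n} (G : Graph n) {u v : Fin n} → Adjacent G u v → v ∈ N G u
adjacent⇒∈N G {u} {v} uv = lookup⇒[]= v (N G u) (trans (lookup∘tabulate (adj G u) v) uv)

x∈p∧x∉q⇒∣p∩q∣<∣p∣ : ∀ {n} {p q : Subset n} {x : Fin n} →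
  x ∈ p → x ∉ q → ∣ p ∩ q ∣ < ∣ p ∣
x∈p∧x∉q⇒∣p∩q∣<∣p∣ {p = p} {q} {x} x∈p x∉q =
  p⊂q⇒∣p∣<∣q∣ (p∩q⊆p p q , x , x∈p , λ x∈p∩q → x∉q (p∩q⊆q p q x∈p∩q))

∣p∣≤∣p∩q∣⇒p⊆q : ∀ {n} (p q : Subset n) → ∣ p ∣ ≤ ∣ p ∩ q ∣ → p ⊆ q
∣p∣≤∣p∩q∣⇒p⊆q p q ∣p∣≤∣p∩q∣ {x} x∈p with x ∈? q
... | yes x∈q = x∈q
... | no  x∉q = contradiction ∣p∣≤∣p∩q∣ (<⇒≱ (x∈p∧x∉q⇒∣p∩q∣<∣p∣ x∈p x∉q))

module _ {n} (G : Graph n) (S : Subset n) where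

  deg≡2⇒N⊆S : (∀ v → ∣ N[ G ] S v ∣ ≥ 2) → ∀ {u} → deg G u ≡ 2 → N G u ⊆ S
  deg≡2⇒N⊆S ∣N[S]∣≥2 {u} degu≡2 =
    ∣p∣≤∣p∩q∣⇒p⊆q (N G u) S (≤-trans (≤-reflexive degu≡2) (∣N[S]∣≥2 u))

  neighbour-of-deg≡2⇒∈N[S] : (∀ v → ∣ N[ G ] S v ∣ ≥ 2) → ∀ {u v} →
    Adjacent G v u → deg G u ≡ 2 → v ∈ N[ G ] S u
  neighbour-of-deg≡2⇒∈N[S] ∣N[S]∣≥2 {u} {v} vu degu≡2 =
    x∈p∩q⁺ (v∈Nu , deg≡2⇒N⊆S ∣N[S]∣≥2 degu≡2 v∈Nu)
    where
    v∈Nu : v ∈ N G u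
    v∈Nu = adjacent⇒∈N G (trans (adj-sym G u v) vu)

  common-neighbour⇒∣N[S]─N[S]∣<2 : ∀ {u w v} →
    v ∈ N[ G ] S u → v ∈ N[ G ] S w → deg G u ≡ 2 →
    ∣ N[ G ] S u ─ N[ G ] S w ∣ < 2
  common-neighbour⇒∣N[S]─N[S]∣<2 {u} {w} {v} v∈Su v∈Sw degu≡2 =
    <-≤-trans (p∩q≢∅⇒∣p─q∣<∣p∣ (N[ G ] S u) (N[ G ] S w) (v , x∈p∩q⁺ (v∈Su , v∈Sw)))
              (≤-trans (∣p∩q∣≤∣p∣ (N G u) S) (≤-reflexive degu≡2))

mainTheorem2 : ∀ {n} (G : Graph n) (S : Subset n) → IsDETOLD G S →
    ∀ (v u w : Fin n) → Adjacent G v u → Adjacent G v w →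
    deg G u ≡ 2 → deg G w ≡ 2 → u ≡ w
mainTheorem2 G S (∣N[S]∣≥2 , separates) v u w vu vw degu≡2 degw≡2 with u ≟ w
... | yes u≡w = u≡w
... | no  u≢w = contradiction (separates u w u≢w)
  [ <⇒≱ (common-neighbour⇒∣N[S]─N[S]∣<2 G S v∈Su v∈Sw degu≡2)
  , <⇒≱ (common-neighbour⇒∣N[S]─N[S]∣<2 G S v∈Sw v∈Su degw≡2) ]
  where
  v∈Su : v ∈ N[ G ] S u
  v∈Su = neighbour-of-deg≡2⇒∈N[S] G S ∣N[S]∣≥2 vu degu≡2
  v∈Sw : v ∈ N[ G ] S w
  v∈Sw = neighbour-of-deg≡2⇒∈N[S] G S ∣N[S]∣≥2 vw degw≡2
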